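{- Assume the transversal matroid $M$ has a presentation by a multiset $\mathcal{A}$ of $\sigma$-intervals that satisfies the following condition: (C) if $I\subseteq J$ for $I,J\in\mathcal{A}$, then either $f_J$ or $l_J$ is in $I$. Then $M$ is a multi-path matroid and $\mathcal{A}$ contains a $\sigma$-interval presentation of $M$.
   Context: Fix a cyclic permutation $\sigma$ of a finite set $S$. A $\sigma$-interval is a nonempty subset $I$ of $S$ of the form $\{f_I,\sigma(f_I),\sigma^2(f_I),\ldots,l_I\}$, with first element $f_I$ and last element $l_I$. A multi-path matroid is a transversal matroid that has a presentation by an antichain of $\sigma$-intervals (a $\sigma$-interval presentation) for some cyclic permutation $\sigma$ of the ground set. A presentation $(A_1,\ldots,A_r)$ of a transversal matroid contains the presentation $(A'_1,\ldots,A'_r)$ if $A'_i\subseteq A_i$ for all $i$. -}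

module Defs where

open import Data.Nat using (ℕ; zero; suc; _≤_; _<_; _∸_)
open import Data.Fin using (Fin)
open import Data.Fin.Subset using (Subset; _∈_; ∣_∣)
open import Data.Fin.Permutation using (Permutation′; _⟨$⟩ʳ_)
open import Data.Product using (Σ; ∃; _×_; _,_; proj₁; proj₂)
open import Data.Sum using (_⊎_)
open import Relation.Binary.PropositionalEquality using (_≡_; _≢_)
open import Relation.Nullary using (¬_)
open import Function.Bundles using (_⇔_)

iter : ∀ {n} → Permutation′ n → ℕ → Fin n → Fin n
iter σ zero    x = x
iter σ (suc k) x = σ ⟨$⟩ʳ (iter σ k x)

IsCyclic : ∀ {n} → Permutation′ n → Set
IsCyclic {n} σ = ∀ (x y : Fin n) → ∃ λ k → iter σ k x ≡ y

record Interval (n : ℕ) : Set where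
  constructor interval
  field
    first  : Fin n
    len    : ℕ
    len≥1  : 1 ≤ len
    len≤n  : len ≤ n
open Interval public

_∈I[_]_ : ∀ {n} → Fin n → Permutation′ n → Interval n → Set
x ∈I[ σ ] I = ∃ λ i → (i < len I) × (iter σ i (first I) ≡ x)

last : ∀ {n} → Permutation′ n → Interval n → Fin n
last σ I = iter σ (len I ∸ 1) (first I)

_⊆I[_]_ : ∀ {n} → Interval n → Permutation′ n → Interval n → Set
I ⊆I[ σ ] J = ∀ x → x ∈I[ σ ] I → x ∈I[ σ ] J

PartialTransversal : ∀ {n r} → Permutation′ n → (Fin r → Interval n) → Subset n → Set
PartialTransversal {n} {r} σ A X =
  Σ ((x : Fin n) → x ∈ X → Fin r) λ φ →
    (∀ x y (p : x ∈ X) (q : y ∈ X) → φ x p ≡ φ y q → x ≡ y) ×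
    (∀ x (p : x ∈ X) → x ∈I[ σ ] A (φ x p))

HasRank : ∀ {n} → (Subset n → Set) → ℕ → Set
HasRank Indep r = (∃ λ X → Indep X × ∣ X ∣ ≡ r) × (∀ X → Indep X → ∣ X ∣ ≤ r)

IsPresentation : ∀ {n r} → Permutation′ n → (Fin r → Interval n) → (Subset n → Set) → Set
IsPresentation {r = r} σ A Indep = (∀ X → Indep X ⇔ PartialTransversal σ A X) × HasRank Indep r

-- antichain (as a multiset: distinct members are incomparable)
IsAntichain : ∀ {n r} → Permutation′ n → (Fin r → Interval n) → Set
IsAntichain {r = r} σ A = ∀ (i j : Fin r) → i ≢ j → ¬ (A i ⊆I[ σ ] A j)

Contains : ∀ {n r} → Permutation′ n → (Fin r → Interval n) → (Fin r → Interval n) → Set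
Contains σ A A' = ∀ i → A' i ⊆I[ σ ] A i

CondC : ∀ {n r} → Permutation′ n → (Fin r → Interval n) → Set
CondC {r = r} σ A = ∀ (i j : Fin r) → A i ⊆I[ σ ] A j →
  (first (A j) ∈I[ σ ] A i) ⊎ (last σ (A j) ∈I[ σ ] A i)

IsMultiPath : ∀ {n} → (Subset n → Set) → Set
IsMultiPath {n} Indep = Σ (Permutation′ n) λ τ → IsCyclic τ × Σ ℕ λ r → Σ (Fin r → Interval n) λ B →
  IsAntichain τ B × IsPresentation τ B Indep

-- While two members I ⊆ J of the presentation are nested, choose J longest among the
-- members containing it. By (C) an endpoint e of J lies in I; replace J by J ∖ {e}.
-- The partial transversals do not change: a matching sending e to J can exchange the
-- roles of I and J, since what it sends to I lies in J ∖ {e}. Condition (C) survives,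
-- the choice of J taking care of the members containing J ∖ {e}. J is never a single
-- point, for a transversal of size r would match that point to both I and J. The total
-- length decreases, so the process ends in an antichain contained in the presentation.

module Submission where

open import Defs
open import Data.Nat using (ℕ)
open import Data.Fin using (Fin)
open import Data.Fin.Subset using (Subset)
open import Data.Fin.Permutation using (Permutation′)
open import Data.Product using (Σ; _×_)

open import Data.Nat using (zero; suc; pred; _≤_; _<_; _∸_; _+_; _*_; z≤n; s≤s; s≤s⁻¹; _≤?_; _<?_; >-nonZero)
open import Data.Nat.Properties
  using (≤-trans; ≤-reflexive; ≤-antisym; <-irrefl; <-trans; <-≤-trans; ≤-<-trans; <⇒≤; <⇒≱; ≮⇒≥; ≰⇒>; ≤∧≮⇒≡;
         <-cmp; n<1+n; m∸n≤m; m∸n+n≡m; m<n⇒0<n∸m; ∸-monoˡ-≤; ∸-monoʳ-<; ∸-cancelˡ-≡; +-mono-<-≤; +-mono-≤-<;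
         +-0-monoid; pred[n]≤n; suc[m]≤n⇒m≤pred[n]; m≤pred[n]⇒suc[m]≤n; <⇒≤pred; anyUpTo?)
open import Data.Nat.DivMod using (_%_; _/_; m≡m%n+[m/n]*n; m%n<n)
open import Data.Nat.Induction using (<-wellFounded)
open import Data.Fin as Fin using (toℕ; fromℕ<; punchOut)
open import Data.Fin.Properties using (_≟_; any?; all?; injective⇒≤; toℕ-fromℕ<; punchOut-injective; suc-injective)
open import Data.Fin.Subset using (_∈_; ∣_∣; inside; outside)
open import Data.Fin.Subset.Properties using (_∈?_)
open import Data.Fin.Permutation using (_⟨$⟩ʳ_; transpose)
open import Data.Vec using ([]; _∷_; here; there)
open import Data.Vec.Properties.WithK using ([]=-irrelevant)
open import Data.Vec.Functional using (updateAt)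
open import Data.Vec.Functional.Properties using (updateAt-updates; updateAt-minimal)
open import Algebra.Properties.Monoid.Sum +-0-monoid using (sum; sum-cong-≗)
open import Data.Product using (∃; _,_; proj₁; proj₂)
open import Data.Sum using (_⊎_; inj₁; inj₂)
open import Data.Empty using (⊥-elim)
open import Induction.WellFounded using (Acc; acc)
open import Relation.Binary.PropositionalEquality
  using (_≡_; _≢_; refl; sym; trans; cong; subst; subst₂; module ≡-Reasoning)
open import Relation.Binary.Definitions using (tri<; tri≈; tri>)
open import Relation.Nullary using (¬_; Dec; yes; no)
open import Relation.Nullary.Decidable using (¬?; _×-dec_; _→-dec_; dec-true; dec-false)
open import Function.Base using (_∘_; const)
open import Function.Bundles using (_⇔_; Injection; Equivalence; mk⇔)
open import Function.Properties.Inverse using (↔⇒↣)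
import Function.Properties.Equivalence as ⇔

InjectiveOn : ∀ {n m} (X : Subset n) → ((x : Fin n) → x ∈ X → Fin m) → Set
InjectiveOn {n} X φ = ∀ (x y : Fin n) (p : x ∈ X) (q : y ∈ X) → φ x p ≡ φ y q → x ≡ y

cong-∈ : ∀ {n} {A : Set} {X : Subset n} (φ : (x : Fin n) → x ∈ X → A) {x y}
  (p : x ∈ X) (q : y ∈ X) → x ≡ y → φ x p ≡ φ y q
cong-∈ φ p q refl = cong (φ _) ([]=-irrelevant p q)

injectiveOn⇒∣X∣≤ : ∀ {n m} (X : Subset n) (φ : (x : Fin n) → x ∈ X → Fin m) →
  InjectiveOn X φ → ∣ X ∣ ≤ m
injectiveOn⇒∣X∣≤ {zero} [] φ φ-inj = z≤n
injectiveOn⇒∣X∣≤ {suc n} (outside ∷ X) φ φ-inj =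
  injectiveOn⇒∣X∣≤ X (λ x p → φ (Fin.suc x) (there p)) (λ x y p q → suc-injective ∘ φ-inj _ _ _ _)
injectiveOn⇒∣X∣≤ {suc n} {zero} (inside ∷ X) φ φ-inj with φ Fin.zero here
... | ()
injectiveOn⇒∣X∣≤ {suc n} {suc m} (inside ∷ X) φ φ-inj = s≤s (injectiveOn⇒∣X∣≤ X ψ ψ-inj)
  where
  avoids : ∀ x (p : x ∈ X) → φ Fin.zero here ≢ φ (Fin.suc x) (there p)
  avoids x p eq with φ-inj _ _ _ _ eq
  ... | ()
  ψ : (x : Fin n) → x ∈ X → Fin m
  ψ x p = punchOut (avoids x p)
  ψ-inj : InjectiveOn X ψ
  ψ-inj x y p q eq = suc-injective (φ-inj _ _ _ _ (punchOut-injective (avoids x p) (avoids y q) eq))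

injectiveOn∧∣X∣≡m⇒onto : ∀ {n m} (X : Subset n) (φ : (x : Fin n) → x ∈ X → Fin m) →
  InjectiveOn X φ → ∣ X ∣ ≡ m → ∀ v → ¬ (∀ x (p : x ∈ X) → φ x p ≢ v)
injectiveOn∧∣X∣≡m⇒onto {m = zero} X φ φ-inj ∣X∣≡m () misses
injectiveOn∧∣X∣≡m⇒onto {m = suc m} X φ φ-inj ∣X∣≡m v misses =
  <-irrefl refl (subst (_≤ m) ∣X∣≡m (injectiveOn⇒∣X∣≤ X ψ ψ-inj))
  where
  ψ : (x : Fin _) → x ∈ X → Fin m
  ψ x p = punchOut (misses x p ∘ sym)
  ψ-inj : InjectiveOn X ψ
  ψ-inj x y p q eq = φ-inj x y p q (punchOut-injective (misses x p ∘ sym) (misses y q ∘ sym) eq)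

sum-< : ∀ {r} (f g : Fin r → ℕ) j → g j < f j → (∀ k → k ≢ j → g k ≡ f k) → sum g < sum f
sum-< {suc r} f g Fin.zero gj<fj same =
  +-mono-<-≤ gj<fj (≤-reflexive (sum-cong-≗ (λ k → same (Fin.suc k) λ ())))
sum-< {suc r} f g (Fin.suc j) gj<fj same =
  +-mono-≤-< (≤-reflexive (same Fin.zero λ ()))
    (sum-< (f ∘ Fin.suc) (g ∘ Fin.suc) j gj<fj (λ k k≢j → same (Fin.suc k) (k≢j ∘ suc-injective)))

suc[m∸2]≡m∸1 : ∀ {m} → 2 ≤ m → suc (m ∸ 1 ∸ 1) ≡ m ∸ 1
suc[m∸2]≡m∸1 (s≤s (s≤s _)) = refl

m∸p≡k⇒p≡0 : ∀ {m k p} → m ∸ p ≡ k → m ≤ k → p ≤ m → p ≡ 0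
m∸p≡k⇒p≡0 {m} {p = p} m∸p≡k m≤k p≤m =
  ∸-cancelˡ-≡ p≤m z≤n (≤-antisym (m∸n≤m m p) (subst (m ≤_) (sym m∸p≡k) m≤k))

transpose-i : ∀ {n} (i j : Fin n) → transpose i j ⟨$⟩ʳ i ≡ j
transpose-i i j rewrite dec-true (i ≟ i) refl = refl

transpose-j : ∀ {n} (i j : Fin n) → transpose i j ⟨$⟩ʳ j ≡ i
transpose-j i j with j ≟ i
... | yes j≡i = j≡i
... | no _ rewrite dec-true (j ≟ j) refl = refl

transpose-other : ∀ {n} (i j k : Fin n) → k ≢ i → k ≢ j → transpose i j ⟨$⟩ʳ k ≡ k
transpose-other i j k k≢i k≢j rewrite dec-false (k ≟ i) k≢i | dec-false (k ≟ j) k≢j = refl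

-- Iterates of a permutation

module Iteration {n : ℕ} (σ : Permutation′ n) where

  σ-injective : ∀ {x y} → σ ⟨$⟩ʳ x ≡ σ ⟨$⟩ʳ y → x ≡ y
  σ-injective = Injection.injective (↔⇒↣ σ)

  iter-+ : ∀ a b x → iter σ (a + b) x ≡ iter σ a (iter σ b x)
  iter-+ zero    b x = refl
  iter-+ (suc a) b x = cong (σ ⟨$⟩ʳ_) (iter-+ a b x)

  iter-sucʳ : ∀ k x → iter σ k (σ ⟨$⟩ʳ x) ≡ iter σ (suc k) x
  iter-sucʳ zero    x = refl
  iter-sucʳ (suc k) x = cong (σ ⟨$⟩ʳ_) (iter-sucʳ k x)

  iter-*-fixed : ∀ p x → iter σ p x ≡ x → ∀ q → iter σ (q * p) x ≡ x
  iter-*-fixed p x fixed zero    = refl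
  iter-*-fixed p x fixed (suc q) = begin
    iter σ (p + q * p) x        ≡⟨ iter-+ p (q * p) x ⟩
    iter σ p (iter σ (q * p) x) ≡⟨ cong (iter σ p) (iter-*-fixed p x fixed q) ⟩
    iter σ p x                  ≡⟨ fixed ⟩
    x                           ∎
    where open ≡-Reasoning

module CyclicIteration {n : ℕ} (σ : Permutation′ n) (cyc : IsCyclic σ) where
  open Iteration σ

  -- Reducing exponents mod p sends every y = σᵏ x to one of p values, injectively.
  n≤period : ∀ p x → 1 ≤ p → iter σ p x ≡ x → n ≤ p
  n≤period p@(suc _) x _ fixed = injective⇒≤ offset-injective
    where
    open ≡-Reasoning
    offset : Fin n → Fin p
    offset y = fromℕ< (m%n<n (proj₁ (cyc x y)) p)
    reaches : ∀ y → iter σ (toℕ (offset y)) x ≡ y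
    reaches y = begin
      iter σ (toℕ (offset y)) x             ≡⟨ cong (λ t → iter σ t x) (toℕ-fromℕ< (m%n<n k p)) ⟩
      iter σ (k % p) x                      ≡⟨ cong (iter σ (k % p)) (sym (iter-*-fixed p x fixed (k / p))) ⟩
      iter σ (k % p) (iter σ (k / p * p) x) ≡⟨ sym (iter-+ (k % p) (k / p * p) x) ⟩
      iter σ (k % p + k / p * p) x          ≡⟨ cong (λ t → iter σ t x) (sym (m≡m%n+[m/n]*n k p)) ⟩
      iter σ k x                            ≡⟨ proj₂ (cyc x y) ⟩
      y                                     ∎
      where k = proj₁ (cyc x y)
    offset-injective : ∀ {y z} → offset y ≡ offset z → y ≡ z
    offset-injective {y} {z} eq = trans (sym (reaches y)) (trans (cong (λ t → iter σ (toℕ t) x) eq) (reaches z))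

  iter-<-distinct : ∀ {a b} x → a < b → b < n → iter σ a x ≢ iter σ b x
  iter-<-distinct {a} {b} x a<b b<n eq =
    <⇒≱ (≤-<-trans (m∸n≤m b a) b<n) (n≤period (b ∸ a) (iter σ a x) (m<n⇒0<n∸m a<b) fixed)
    where
    fixed : iter σ (b ∸ a) (iter σ a x) ≡ iter σ a x
    fixed = trans (sym (iter-+ (b ∸ a) a x)) (trans (cong (λ t → iter σ t x) (m∸n+n≡m (<⇒≤ a<b))) (sym eq))

  iter-injectiveˡ : ∀ {a b} x → a < n → b < n → iter σ a x ≡ iter σ b x → a ≡ b
  iter-injectiveˡ {a} {b} x a<n b<n eq with <-cmp a b
  ... | tri< a<b _ _ = ⊥-elim (iter-<-distinct x a<b b<n eq)
  ... | tri≈ _ a≡b _ = a≡b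
  ... | tri> _ _ b<a = ⊥-elim (iter-<-distinct x b<a a<n (sym eq))

-- σ-intervals

module Intervals {n : ℕ} (σ : Permutation′ n) (cyc : IsCyclic σ) where
  open Iteration σ
  open CyclicIteration σ cyc

  infix 4 _∈ᴵ_ _∉ᴵ_ _⊆ᴵ_ _∋end_

  _∈ᴵ_ : Fin n → Interval n → Set
  x ∈ᴵ I = x ∈I[ σ ] I

  _∉ᴵ_ : Fin n → Interval n → Set
  x ∉ᴵ I = ¬ (x ∈ᴵ I)

  _⊆ᴵ_ : Interval n → Interval n → Set
  I ⊆ᴵ J = I ⊆I[ σ ] J

  _∋end_ : Interval n → Interval n → Set
  I ∋end J = first J ∈ᴵ I ⊎ last σ J ∈ᴵ I

  ⊆ᴵ-trans : ∀ {I J K} → I ⊆ᴵ J → J ⊆ᴵ K → I ⊆ᴵ K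
  ⊆ᴵ-trans I⊆J J⊆K x = J⊆K x ∘ I⊆J x

  _∈ᴵ?_ : ∀ x I → Dec (x ∈ᴵ I)
  x ∈ᴵ? I = anyUpTo? (λ k → iter σ k (first I) ≟ x) (len I)

  _⊆ᴵ?_ : ∀ I J → Dec (I ⊆ᴵ J)
  I ⊆ᴵ? J = all? (λ x → x ∈ᴵ? I →-dec x ∈ᴵ? J)

  len∸1<len : (I : Interval n) → len I ∸ 1 < len I
  len∸1<len I = ∸-monoʳ-< (s≤s z≤n) (len≥1 I)

  <len∸1⇒suc<len : (I : Interval n) → ∀ {a} → a < len I ∸ 1 → suc a < len I
  <len∸1⇒suc<len I = m≤pred[n]⇒suc[m]≤n {{>-nonZero (len≥1 I)}}

  position<n : (I : Interval n) → ∀ {a} → a < len I → a < n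
  position<n I a<len = <-≤-trans a<len (len≤n I)

  first∈ : (I : Interval n) → first I ∈ᴵ I
  first∈ I = 0 , len≥1 I , refl

  last∈ : (I : Interval n) → last σ I ∈ᴵ I
  last∈ I = len I ∸ 1 , len∸1<len I , refl

  ⊆ᴵ-insert : ∀ {J K e} → (∀ y → y ∈ᴵ J → y ≢ e → y ∈ᴵ K) → e ∈ᴵ K → J ⊆ᴵ K
  ⊆ᴵ-insert {e = e} others e∈K y y∈J with y ≟ e
  ... | yes refl = e∈K
  ... | no y≢e = others y y∈J y≢e

  ∈-len≡1 : ∀ I {x} → len I ≡ 1 → x ∈ᴵ I → x ≡ first I
  ∈-len≡1 I len≡1 (zero , _ , eq) = sym eq
  ∈-len≡1 I len≡1 (suc a , a<len , _) with subst (suc a <_) len≡1 a<len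
  ... | s≤s ()

  at-last-position : (I : Interval n) → ∀ {a} → a < len I → ¬ (suc a < len I) → iter σ a (first I) ≡ last σ I
  at-last-position I a<len ¬suc<len = cong (λ t → iter σ t (first I)) (cong pred (≤∧≮⇒≡ a<len ¬suc<len))

  ∈ᴵ-pred : ∀ K {x} → σ ⟨$⟩ʳ x ∈ᴵ K → first K ≡ σ ⟨$⟩ʳ x ⊎ x ∈ᴵ K
  ∈ᴵ-pred K (zero , _ , eq) = inj₁ eq
  ∈ᴵ-pred K (suc a , suc-a<len , eq) = inj₂ (a , <-trans (n<1+n a) suc-a<len , σ-injective eq)

  ∈ᴵ-succ : ∀ K {x} → x ∈ᴵ K → x ≡ last σ K ⊎ σ ⟨$⟩ʳ x ∈ᴵ K
  ∈ᴵ-succ K (a , a<len , eq) with suc a <? len K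
  ... | yes suc-a<len = inj₂ (suc a , suc-a<len , cong (σ ⟨$⟩ʳ_) eq)
  ... | no ¬suc-a<len = inj₁ (trans (sym eq) (at-last-position K a<len ¬suc-a<len))

  σ-last∈⇒first : ∀ K → σ ⟨$⟩ʳ last σ K ∈ᴵ K → first K ≡ σ ⟨$⟩ʳ last σ K
  σ-last∈⇒first K (zero , _ , eq) = eq
  σ-last∈⇒first K (suc a , suc-a<len , eq) = ⊥-elim (<-irrefl a≡len∸1 (suc[m]≤n⇒m≤pred[n] suc-a<len))
    where
    a≡len∸1 : a ≡ len K ∸ 1
    a≡len∸1 = iter-injectiveˡ (first K) (position<n K (<-trans (n<1+n a) suc-a<len))
                (position<n K (len∸1<len K)) (σ-injective eq)

  σ∈first⇒last : ∀ K {x} → x ∈ᴵ K → σ ⟨$⟩ʳ x ≡ first K → x ≡ last σ K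
  σ∈first⇒last K (a , a<len , eq) σx≡first with suc a <? len K
  ... | no ¬suc-a<len = trans (sym eq) (at-last-position K a<len ¬suc-a<len)
  ... | yes suc-a<len
    with iter-injectiveˡ (first K) (position<n K suc-a<len) (position<n K (len≥1 K))
           (trans (cong (σ ⟨$⟩ʳ_) eq) σx≡first)
  ...   | ()

  last≢first : ∀ K → 2 ≤ len K → last σ K ≢ first K
  last≢first K 2≤len last≡first = <-irrefl (sym len∸1≡0) (∸-monoˡ-≤ 1 2≤len)
    where
    len∸1≡0 : len K ∸ 1 ≡ 0
    len∸1≡0 = iter-injectiveˡ (first K) (position<n K (len∸1<len K)) (position<n K (len≥1 K)) last≡first

  σ-first∈⇒2≤len : ∀ K → 1 < n → σ ⟨$⟩ʳ first K ∈ᴵ K → 2 ≤ len K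
  σ-first∈⇒2≤len K 1<n (zero , _ , eq) with iter-injectiveˡ (first K) (<⇒≤ 1<n) 1<n eq
  ... | ()
  σ-first∈⇒2≤len K 1<n (suc a , suc-a<len , _) = ≤-trans (s≤s (s≤s z≤n)) suc-a<len

  -- What is needed to replace J by rest in a family without losing (C); the hypothesis
  -- of endsAbove is available when J is longest among the members containing it.
  record Removal (J : Interval n) (e : Fin n) : Set where
    field
      rest      : Interval n
      rest⊆     : rest ⊆ᴵ J
      shorter   : len rest < len J
      ∈rest     : ∀ y → y ∈ᴵ J → y ≢ e → y ∈ᴵ rest
      endsBelow : ∀ K → K ⊆ᴵ rest → K ∋end J → K ∋end rest
      endsAbove : ∀ K → rest ⊆ᴵ K → (J ⊆ᴵ K → J ∋end K × len K ≤ len J) → rest ∋end K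

  endsAbove-by-cases : ∀ {J J′ e K} → (∀ y → y ∈ᴵ J → y ≢ e → y ∈ᴵ J′) → J′ ⊆ᴵ K →
    (e ∉ᴵ K → J′ ∋end K) →
    (J ⊆ᴵ K → first K ≡ e → len K ≤ len J → J′ ∋end K) →
    (J ⊆ᴵ K → last σ K ≡ e → len K ≤ len J → J′ ∋end K) →
    (J ⊆ᴵ K → J ∋end K × len K ≤ len J) → J′ ∋end K
  endsAbove-by-cases {J} {J′} {e} {K} keep J′⊆K ifAbsent ifFirst ifLast above with e ∈ᴵ? K
  ... | no e∉K = ifAbsent e∉K
  ... | yes e∈K = endpoint (above J⊆K)
    where
    J⊆K : J ⊆ᴵ K
    J⊆K = ⊆ᴵ-insert {J} {K} (λ y y∈J y≢e → J′⊆K y (keep y y∈J y≢e)) e∈K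
    endpoint : J ∋end K × len K ≤ len J → J′ ∋end K
    endpoint (inj₁ first∈J , K≤J) with first K ≟ e
    ... | yes first≡e = ifFirst J⊆K first≡e K≤J
    ... | no first≢e = inj₁ (keep _ first∈J first≢e)
    endpoint (inj₂ last∈J , K≤J) with last σ K ≟ e
    ... | yes last≡e = ifLast J⊆K last≡e K≤J
    ... | no last≢e = inj₂ (keep _ last∈J last≢e)

  dropFirst : (J : Interval n) → 2 ≤ len J → Interval n
  dropFirst J 2≤len = interval (σ ⟨$⟩ʳ first J) (len J ∸ 1) (∸-monoˡ-≤ 1 2≤len) (≤-trans pred[n]≤n (len≤n J))

  dropLast : (J : Interval n) → 2 ≤ len J → Interval n
  dropLast J 2≤len = interval (first J) (len J ∸ 1) (∸-monoˡ-≤ 1 2≤len) (≤-trans pred[n]≤n (len≤n J))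

  module DropFirst (J : Interval n) (2≤len : 2 ≤ len J) where

    J′ : Interval n
    J′ = dropFirst J 2≤len

    J′⊆J : J′ ⊆ᴵ J
    J′⊆J x (a , a<len′ , eq) = suc a , <len∸1⇒suc<len J a<len′ , trans (sym (iter-sucʳ a (first J))) eq

    ∈J′ : ∀ y → y ∈ᴵ J → y ≢ first J → y ∈ᴵ J′
    ∈J′ y (zero , _ , eq) y≢first = ⊥-elim (y≢first (sym eq))
    ∈J′ y (suc a , suc-a<len , eq) _ = a , suc[m]≤n⇒m≤pred[n] suc-a<len , trans (iter-sucʳ a (first J)) eq

    first∉J′ : first J ∉ᴵ J′
    first∉J′ (a , a<len′ , eq)
      with iter-injectiveˡ (first J) (position<n J (<len∸1⇒suc<len J a<len′)) (position<n J (len≥1 J))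
             (trans (sym (iter-sucʳ a (first J))) eq)
    ... | ()

    last-J′ : last σ J′ ≡ last σ J
    last-J′ = trans (iter-sucʳ (len J ∸ 1 ∸ 1) (first J)) (cong (λ t → iter σ t (first J)) (suc[m∸2]≡m∸1 2≤len))

    endsBelow : ∀ K → K ⊆ᴵ J′ → K ∋end J → K ∋end J′
    endsBelow K K⊆J′ (inj₁ first∈K) = ⊥-elim (first∉J′ (K⊆J′ _ first∈K))
    endsBelow K K⊆J′ (inj₂ last∈K) = inj₂ (subst (_∈ᴵ K) (sym last-J′) last∈K)

    above-absent : ∀ K → J′ ⊆ᴵ K → first J ∉ᴵ K → J′ ∋end K
    above-absent K J′⊆K first∉K with ∈ᴵ-pred K (J′⊆K _ (first∈ J′))
    ... | inj₁ firstK≡ = inj₁ (subst (_∈ᴵ J′) (sym firstK≡) (first∈ J′))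
    ... | inj₂ first∈K = ⊥-elim (first∉K first∈K)

    above-sharingFirst : ∀ K → J′ ⊆ᴵ K → first K ≡ first J → len K ≤ len J → J′ ∋end K
    above-sharingFirst K J′⊆K firstK≡ K≤J =
      inj₂ (∈J′ (last σ K) last∈J (λ lastK≡ → last≢first K 2≤lenK (trans lastK≡ (sym firstK≡))))
      where
      2≤lenK : 2 ≤ len K
      2≤lenK = σ-first∈⇒2≤len K (<-≤-trans 2≤len (len≤n J))
                 (subst (λ z → σ ⟨$⟩ʳ z ∈ᴵ K) (sym firstK≡) (J′⊆K _ (first∈ J′)))
      last∈J : last σ K ∈ᴵ J
      last∈J = len K ∸ 1 , <-≤-trans (len∸1<len K) K≤J , cong (iter σ (len K ∸ 1)) (sym firstK≡)

    above-endingAtFirst : ∀ K → J′ ⊆ᴵ K → last σ K ≡ first J → J′ ∋end K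
    above-endingAtFirst K J′⊆K lastK≡ = inj₁ (subst (_∈ᴵ J′) (sym firstK≡) (first∈ J′))
      where
      firstK≡ : first K ≡ σ ⟨$⟩ʳ first J
      firstK≡ = trans (σ-last∈⇒first K (subst (λ z → σ ⟨$⟩ʳ z ∈ᴵ K) (sym lastK≡) (J′⊆K _ (first∈ J′))))
                  (cong (σ ⟨$⟩ʳ_) lastK≡)

    removal : Removal J (first J)
    removal = record
      { rest      = J′
      ; rest⊆     = J′⊆J
      ; shorter   = len∸1<len J
      ; ∈rest     = ∈J′
      ; endsBelow = endsBelow
      ; endsAbove = λ K J′⊆K → endsAbove-by-cases {J} {J′} {K = K} ∈J′ J′⊆K (above-absent K J′⊆K)
                      (λ _ → above-sharingFirst K J′⊆K) (λ _ lastK≡ _ → above-endingAtFirst K J′⊆K lastK≡)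
      }

  module DropLast (J : Interval n) (2≤len : 2 ≤ len J) where

    J′ : Interval n
    J′ = dropLast J 2≤len

    J′⊆J : J′ ⊆ᴵ J
    J′⊆J x (a , a<len′ , eq) = a , <-trans a<len′ (len∸1<len J) , eq

    ∈J′ : ∀ y → y ∈ᴵ J → y ≢ last σ J → y ∈ᴵ J′
    ∈J′ y (a , a<len , eq) y≢last with suc a <? len J
    ... | yes suc-a<len = a , suc[m]≤n⇒m≤pred[n] suc-a<len , eq
    ... | no ¬suc-a<len = ⊥-elim (y≢last (trans (sym eq) (at-last-position J a<len ¬suc-a<len)))

    last∉J′ : last σ J ∉ᴵ J′
    last∉J′ (a , a<len′ , eq) = <-irrefl a≡len∸1 a<len′
      where
      a≡len∸1 : a ≡ len J ∸ 1
      a≡len∸1 = iter-injectiveˡ (first J) (position<n J (<-trans a<len′ (len∸1<len J)))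
                  (position<n J (len∸1<len J)) eq

    σ-last-J′ : σ ⟨$⟩ʳ last σ J′ ≡ last σ J
    σ-last-J′ = cong (λ t → iter σ t (first J)) (suc[m∸2]≡m∸1 2≤len)

    endsBelow : ∀ K → K ⊆ᴵ J′ → K ∋end J → K ∋end J′
    endsBelow K K⊆J′ (inj₁ first∈K) = inj₁ first∈K
    endsBelow K K⊆J′ (inj₂ last∈K) = ⊥-elim (last∉J′ (K⊆J′ _ last∈K))

    above-absent : ∀ K → J′ ⊆ᴵ K → last σ J ∉ᴵ K → J′ ∋end K
    above-absent K J′⊆K last∉K with ∈ᴵ-succ K (J′⊆K _ (last∈ J′))
    ... | inj₁ last′≡lastK = inj₂ (subst (_∈ᴵ J′) last′≡lastK (last∈ J′))
    ... | inj₂ σlast′∈K = ⊥-elim (last∉K (subst (_∈ᴵ K) σ-last-J′ σlast′∈K))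

    above-startingAtLast : ∀ K → J′ ⊆ᴵ K → first K ≡ last σ J → J′ ∋end K
    above-startingAtLast K J′⊆K firstK≡ =
      inj₂ (subst (_∈ᴵ J′) (σ∈first⇒last K (J′⊆K _ (last∈ J′)) (trans σ-last-J′ (sym firstK≡))) (last∈ J′))

    -- first J sits at position p of K; reaching the common last point from it takes both
    -- len K ∸ 1 ∸ p and len J ∸ 1 steps, which forces p = 0.
    above-sharingLast : ∀ K → J ⊆ᴵ K → last σ K ≡ last σ J → len K ≤ len J → J′ ∋end K
    above-sharingLast K J⊆K lastK≡ K≤J with J⊆K (first J) (first∈ J)
    ... | p , p<lenK , eq = inj₁ (subst (_∈ᴵ J′) (trans (sym eq) (cong (λ t → iter σ t (first K)) p≡0)) (first∈ J′))
      where
      open ≡-Reasoning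
      p≤len∸1 : p ≤ len K ∸ 1
      p≤len∸1 = <⇒≤pred p<lenK
      reach : iter σ (len K ∸ 1 ∸ p) (first J) ≡ iter σ (len J ∸ 1) (first J)
      reach = begin
        iter σ (len K ∸ 1 ∸ p) (first J)            ≡⟨ cong (iter σ (len K ∸ 1 ∸ p)) (sym eq) ⟩
        iter σ (len K ∸ 1 ∸ p) (iter σ p (first K)) ≡⟨ sym (iter-+ (len K ∸ 1 ∸ p) p (first K)) ⟩
        iter σ (len K ∸ 1 ∸ p + p) (first K)        ≡⟨ cong (λ t → iter σ t (first K)) (m∸n+n≡m p≤len∸1) ⟩
        last σ K                                    ≡⟨ lastK≡ ⟩
        last σ J                                    ∎
      p≡0 : p ≡ 0
      p≡0 = m∸p≡k⇒p≡0
              (iter-injectiveˡ (first J) (position<n K (≤-<-trans (m∸n≤m _ p) (len∸1<len K)))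
                 (position<n J (len∸1<len J)) reach)
              (∸-monoˡ-≤ 1 K≤J) p≤len∸1

    removal : Removal J (last σ J)
    removal = record
      { rest      = J′
      ; rest⊆     = J′⊆J
      ; shorter   = len∸1<len J
      ; ∈rest     = ∈J′
      ; endsBelow = endsBelow
      ; endsAbove = λ K J′⊆K → endsAbove-by-cases {J} {J′} {K = K} ∈J′ J′⊆K (above-absent K J′⊆K)
                      (λ _ firstK≡ _ → above-startingAtLast K J′⊆K firstK≡) (above-sharingLast K)
      }

  removeEndpoint : ∀ {I} J → 2 ≤ len J → I ∋end J → ∃ λ e → e ∈ᴵ I × Removal J e
  removeEndpoint J 2≤len (inj₁ first∈I) = first J , first∈I , DropFirst.removal J 2≤len
  removeEndpoint J 2≤len (inj₂ last∈I) = last σ J , last∈I , DropLast.removal J 2≤len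

-- Families of σ-intervals

module Families {n : ℕ} (σ : Permutation′ n) (cyc : IsCyclic σ) {r : ℕ} where
  open Intervals σ cyc

  _[_]≔_ : (Fin r → Interval n) → Fin r → Interval n → Fin r → Interval n
  B [ j ]≔ J′ = updateAt B j (const J′)

  ∈-[]≔ : ∀ B j J′ {k x} → x ∈ᴵ B k → (k ≡ j → x ∈ᴵ J′) → x ∈ᴵ (B [ j ]≔ J′) k
  ∈-[]≔ B j J′ {k} {x} x∈Bk x∈J′ with k ≟ j
  ... | yes refl = subst (x ∈ᴵ_) (sym (updateAt-updates k B)) (x∈J′ refl)
  ... | no k≢j = subst (x ∈ᴵ_) (sym (updateAt-minimal k j B k≢j)) x∈Bk

  []≔-contained : ∀ B j {J′} → J′ ⊆ᴵ B j → Contains σ B (B [ j ]≔ J′)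
  []≔-contained B j J′⊆Bj k x x∈ with k ≟ j
  ... | yes refl = J′⊆Bj x (subst (x ∈ᴵ_) (updateAt-updates k B) x∈)
  ... | no k≢j = subst (x ∈ᴵ_) (updateAt-minimal k j B k≢j) x∈

  sum-len-[]≔ : ∀ B j {J′} → len J′ < len (B j) → sum (len ∘ (B [ j ]≔ J′)) < sum (len ∘ B)
  sum-len-[]≔ B j J′<Bj = sum-< (len ∘ B) (len ∘ (B [ j ]≔ _)) j
    (subst (λ K → len K < len (B j)) (sym (updateAt-updates j B)) J′<Bj)
    (λ k k≢j → cong len (updateAt-minimal k j B k≢j))

  transversal-contained : ∀ {B B′ : Fin r → Interval n} {X} → Contains σ B B′ →
    PartialTransversal σ B′ X → PartialTransversal σ B X
  transversal-contained B⊇B′ (φ , φ-inj , φ∈) = φ , φ-inj , λ x p → B⊇B′ (φ x p) x (φ∈ x p)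

  module Rematch {B : Fin r → Interval n} {i j : Fin r} {J′ : Interval n} {e : Fin n} {X : Subset n}
    (i≢j : i ≢ j) (Bi⊆Bj : B i ⊆ᴵ B j) (e∈Bi : e ∈ᴵ B i) (keep : ∀ y → y ∈ᴵ B j → y ≢ e → y ∈ᴵ J′)
    (φ : (x : Fin n) → x ∈ X → Fin r) (φ-inj : InjectiveOn X φ) (φ∈ : ∀ x p → x ∈ᴵ B (φ x p)) where

    φ∈-[]≔ : (∀ x p → φ x p ≡ j → x ≢ e) → ∀ x p → x ∈ᴵ (B [ j ]≔ J′) (φ x p)
    φ∈-[]≔ e-elsewhere x p = ∈-[]≔ B j J′ (φ∈ x p)
      (λ φx≡j → keep x (subst (λ k → x ∈ᴵ B k) φx≡j (φ∈ x p)) (e-elsewhere x p φx≡j))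

    -- When e is matched to j, exchange i and j: e goes to B i, and the element matched
    -- to i, which lies in B i ⊆ B j and differs from e, goes to J′.
    transposed∈-[]≔ : (e∈X : e ∈ X) → φ e e∈X ≡ j → ∀ x p → Dec (φ x p ≡ j) → Dec (φ x p ≡ i) →
      x ∈ᴵ (B [ j ]≔ J′) (transpose i j ⟨$⟩ʳ φ x p)
    transposed∈-[]≔ e∈X φe≡j x p (yes φx≡j) _ =
      subst (λ k → x ∈ᴵ (B [ j ]≔ J′) k) (sym (trans (cong (transpose i j ⟨$⟩ʳ_) φx≡j) (transpose-j i j)))
        (∈-[]≔ B j J′ (subst (_∈ᴵ B i) (sym x≡e) e∈Bi) (⊥-elim ∘ i≢j))
      where
      x≡e : x ≡ e
      x≡e = φ-inj x e p e∈X (trans φx≡j (sym φe≡j))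
    transposed∈-[]≔ e∈X φe≡j x p (no _) (yes φx≡i) =
      subst (λ k → x ∈ᴵ (B [ j ]≔ J′) k) (sym (trans (cong (transpose i j ⟨$⟩ʳ_) φx≡i) (transpose-i i j)))
        (∈-[]≔ B j J′ (Bi⊆Bj x x∈Bi) (λ _ → keep x (Bi⊆Bj x x∈Bi) x≢e))
      where
      x∈Bi : x ∈ᴵ B i
      x∈Bi = subst (λ k → x ∈ᴵ B k) φx≡i (φ∈ x p)
      x≢e : x ≢ e
      x≢e x≡e = i≢j (trans (sym φx≡i) (trans (cong-∈ φ p e∈X x≡e) φe≡j))
    transposed∈-[]≔ e∈X φe≡j x p (no φx≢j) (no φx≢i) =
      subst (λ k → x ∈ᴵ (B [ j ]≔ J′) k) (sym (transpose-other i j _ φx≢i φx≢j))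
        (∈-[]≔ B j J′ (φ∈ x p) (⊥-elim ∘ φx≢j))

    rematch : PartialTransversal σ (B [ j ]≔ J′) X
    rematch with e ∈? X
    ... | no e∉X = φ , φ-inj , φ∈-[]≔ (λ x p _ x≡e → e∉X (subst (_∈ X) x≡e p))
    ... | yes e∈X with φ e e∈X ≟ j
    ...   | no φe≢j = φ , φ-inj , φ∈-[]≔ (λ x p φx≡j x≡e → φe≢j (trans (cong-∈ φ e∈X p (sym x≡e)) φx≡j))
    ...   | yes φe≡j = (λ x p → transpose i j ⟨$⟩ʳ φ x p)
                     , (λ x y p q → φ-inj x y p q ∘ Injection.injective (↔⇒↣ (transpose i j)))
                     , λ x p → transposed∈-[]≔ e∈X φe≡j x p (φ x p ≟ j) (φ x p ≟ i)

  transversal-[]≔ : ∀ {B i j J′ e X} → i ≢ j → B i ⊆ᴵ B j → e ∈ᴵ B i →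
    (∀ y → y ∈ᴵ B j → y ≢ e → y ∈ᴵ J′) →
    PartialTransversal σ B X → PartialTransversal σ (B [ j ]≔ J′) X
  transversal-[]≔ i≢j Bi⊆Bj e∈Bi keep (φ , φ-inj , φ∈) = Rematch.rematch i≢j Bi⊆Bj e∈Bi keep φ φ-inj φ∈

  NestedEnds : Interval n → Interval n → Set
  NestedEnds K L = K ⊆ᴵ L → K ∋end L

  LongestAbove : (Fin r → Interval n) → Fin r → Set
  LongestAbove B j = ∀ k → k ≢ j → B j ⊆ᴵ B k → len (B k) ≤ len (B j)

  module _ {B : Fin r → Interval n} {j : Fin r} {e : Fin n} (C : CondC σ B) (R : Removal (B j) e)
    (longest : LongestAbove B j) where
    open Removal R

    private
      updated : (B [ j ]≔ rest) j ≡ rest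
      updated = updateAt-updates j B

      untouched : ∀ {k} → k ≢ j → (B [ j ]≔ rest) k ≡ B k
      untouched {k} k≢j = updateAt-minimal k j B k≢j

    condC-[]≔ : CondC σ (B [ j ]≔ rest)
    condC-[]≔ a b with a ≟ j | b ≟ j
    ... | yes refl | yes refl = subst₂ NestedEnds (sym updated) (sym updated) (λ _ → inj₁ (first∈ rest))
    ... | yes refl | no b≢j = subst₂ NestedEnds (sym updated) (sym (untouched b≢j))
                                (λ rest⊆Bb → endsAbove (B b) rest⊆Bb (λ Bj⊆Bb → C j b Bj⊆Bb , longest b b≢j Bj⊆Bb))
    ... | no a≢j | yes refl = subst₂ NestedEnds (sym (untouched a≢j)) (sym updated)
                                (λ Ba⊆rest → endsBelow (B a) Ba⊆rest (C a j (⊆ᴵ-trans {B a} {rest} {B j} Ba⊆rest rest⊆)))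
    ... | no a≢j | no b≢j = subst₂ NestedEnds (sym (untouched a≢j)) (sym (untouched b≢j)) (C a b)

  fullTransversal⇒nested-len≢1 : ∀ {B : Fin r → Interval n} {i j X} → PartialTransversal σ B X → ∣ X ∣ ≡ r →
    i ≢ j → B i ⊆ᴵ B j → len (B j) ≢ 1
  fullTransversal⇒nested-len≢1 {B} {i} {j} {X} (φ , φ-inj , φ∈) ∣X∣≡r i≢j Bi⊆Bj len≡1 =
    onto i λ x p φx≡i → onto j λ y q φy≡j → i≢j (begin
      i       ≡⟨ sym φx≡i ⟩
      φ x p   ≡⟨ cong-∈ φ p q (trans (atFirst (Bi⊆Bj x (memberAt p φx≡i))) (sym (atFirst (memberAt q φy≡j)))) ⟩
      φ y q   ≡⟨ φy≡j ⟩
      j       ∎)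
    where
    open ≡-Reasoning
    onto = injectiveOn∧∣X∣≡m⇒onto X φ φ-inj ∣X∣≡r
    atFirst : ∀ {x} → x ∈ᴵ B j → x ≡ first (B j)
    atFirst = ∈-len≡1 (B j) len≡1
    memberAt : ∀ {x k} (p : x ∈ X) → φ x p ≡ k → x ∈ᴵ B k
    memberAt {x} p refl = φ∈ x p

  Nested : (Fin r → Interval n) → Set
  Nested B = ∃ λ i → ∃ λ j → i ≢ j × B i ⊆ᴵ B j

  antichain⊎nested : ∀ B → IsAntichain σ B ⊎ Nested B
  antichain⊎nested B with any? (λ i → any? (λ j → ¬? (i ≟ j) ×-dec B i ⊆ᴵ? B j))
  ... | yes (i , j , i≢j , Bi⊆Bj) = inj₂ (i , j , i≢j , Bi⊆Bj)
  ... | no none = inj₁ (λ i j i≢j Bi⊆Bj → none (i , j , i≢j , Bi⊆Bj))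

  MaximallyNested : (Fin r → Interval n) → Set
  MaximallyNested B = ∃ λ i → ∃ λ j → i ≢ j × B i ⊆ᴵ B j × LongestAbove B j

  nested⇒maximallyNested : ∀ B → Nested B → MaximallyNested B
  nested⇒maximallyNested B (i , j , i≢j , Bi⊆Bj) = climb i j (<-wellFounded _) i≢j Bi⊆Bj
    where
    climb : ∀ i j → Acc _<_ (n ∸ len (B j)) → i ≢ j → B i ⊆ᴵ B j → MaximallyNested B
    climb i j (acc smaller) i≢j Bi⊆Bj
      with any? (λ k → ¬? (k ≟ j) ×-dec B j ⊆ᴵ? B k ×-dec len (B j) <? len (B k))
    ... | yes (k , k≢j , Bj⊆Bk , longer) =
      climb j k (smaller (∸-monoʳ-< longer (len≤n (B k)))) (k≢j ∘ sym) Bj⊆Bk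
    ... | no none = i , j , i≢j , Bi⊆Bj , λ k k≢j Bj⊆Bk → ≮⇒≥ (λ longer → none (k , k≢j , Bj⊆Bk , longer))

-- Shrinking a presentation to an antichain

module Reduction {n r : ℕ} (σ : Permutation′ n) (cyc : IsCyclic σ) (Indep : Subset n → Set)
  (A : Fin r → Interval n) where
  open Intervals σ cyc
  open Families σ cyc {r}

  record Admissible (B : Fin r → Interval n) : Set where
    field
      contained : Contains σ A B
      presents  : IsPresentation σ B Indep
      condC     : CondC σ B

  nested⇒2≤len : ∀ {B : Fin r → Interval n} {i j} → IsPresentation σ B Indep → i ≢ j → B i ⊆ᴵ B j → 2 ≤ len (B j)
  nested⇒2≤len {B} {j = j} (Indep⇔PT , (X , X-indep , ∣X∣≡r) , _) i≢j Bi⊆Bj with 2 ≤? len (B j)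
  ... | yes 2≤len = 2≤len
  ... | no 2≰len = ⊥-elim (fullTransversal⇒nested-len≢1 {B} (Equivalence.to (Indep⇔PT X) X-indep) ∣X∣≡r i≢j Bi⊆Bj
                             (≤-antisym (s≤s⁻¹ (≰⇒> 2≰len)) (len≥1 (B j))))

  presentation-cong : ∀ {B B′ : Fin r → Interval n} →
    (∀ X → PartialTransversal σ B X ⇔ PartialTransversal σ B′ X) →
    IsPresentation σ B Indep → IsPresentation σ B′ Indep
  presentation-cong B⇔B′ (Indep⇔B , rank) = (λ X → ⇔.trans (Indep⇔B X) (B⇔B′ X)) , rank

  totalLength : (Fin r → Interval n) → ℕ
  totalLength B = sum (len ∘ B)

  shrink : ∀ {B : Fin r → Interval n} → Admissible B → Nested B →
    ∃ λ B′ → Admissible B′ × totalLength B′ < totalLength B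
  shrink {B} adm nested with nested⇒maximallyNested B nested
  ... | i , j , i≢j , Bi⊆Bj , longest
    with removeEndpoint {B i} (B j) (nested⇒2≤len {B} (Admissible.presents adm) i≢j Bi⊆Bj)
           (Admissible.condC adm i j Bi⊆Bj)
  ...   | e , e∈Bi , R = B [ j ]≔ rest , admissible , sum-len-[]≔ B j shorter
    where
    open Admissible adm
    open Removal R
    B⊇B′ : Contains σ B (B [ j ]≔ rest)
    B⊇B′ = []≔-contained B j rest⊆
    sameTransversals : ∀ X → PartialTransversal σ B X ⇔ PartialTransversal σ (B [ j ]≔ rest) X
    sameTransversals X =
      mk⇔ (transversal-[]≔ {B} {J′ = rest} i≢j Bi⊆Bj e∈Bi ∈rest) (transversal-contained {B} {B [ j ]≔ rest} B⊇B′)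
    admissible : Admissible (B [ j ]≔ rest)
    admissible = record
      { contained = λ k x x∈ → contained k x (B⊇B′ k x x∈)
      ; presents  = presentation-cong {B} {B [ j ]≔ rest} sameTransversals presents
      ; condC     = condC-[]≔ condC R longest
      }

  reduce : ∀ B → Acc _<_ (totalLength B) → Admissible B → ∃ λ B′ → Admissible B′ × IsAntichain σ B′
  reduce B (acc smaller) adm with antichain⊎nested B
  ... | inj₁ antichain = B , adm , antichain
  ... | inj₂ nested with shrink adm nested
  ...   | B′ , adm′ , shorter = reduce B′ (smaller shorter) adm′

lemma3p2 : ∀ {n r} (σ : Permutation′ n) → IsCyclic σ →
    (Indep : Subset n → Set) (A : Fin r → Interval n) →
    IsPresentation σ A Indep → CondC σ A →
    IsMultiPath Indep ×
    Σ (Fin r → Interval n) (λ A' → Contains σ A A' × IsAntichain σ A' × IsPresentation σ A' Indep)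
lemma3p2 {r = r} σ cyc Indep A presentsA condCA
  with Reduction.reduce σ cyc Indep A A (<-wellFounded _)
         record { contained = λ _ _ x∈ → x∈ ; presents = presentsA ; condC = condCA }
... | A′ , admissible , antichain =
  (σ , cyc , r , A′ , antichain , presents) , A′ , contained , antichain , presents
  where open Reduction.Admissible admissible
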